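{- Let $c$ denote the largest real root of the equation $x^6-2x^2-2x-1=0$ (so $c=1.40759\ldots<\sqrt{2}$). Then for all integers $n\ge 1$ and $t\ge 0$, we have $\mathrm{mis}_{\triangle,t}(n)\le 2^t c^{\,n-2t}$.
   Context: All graphs are finite and simple. For a graph $G$, $\mathrm{mis}(G)$ denotes the number of maximal independent sets of $G$. An induced matching in $G$ is an induced subgraph of $G$ that is a matching (a vertex-disjoint union of edges); its size is the number of edges. For integers $n\ge1$, $t\ge 0$, $\mathrm{mis}_{\triangle,t}(n)$ denotes the maximum of $\mathrm{mis}(G)$ over all $n$-vertex triangle-free graphs $G$ that do not contain an induced matching of size $t+1$. -}

module Defs where

open import Data.Nat as ℕ using (ℕ; zero; suc)
open import Data.Bool using (Bool; true; false)
open import Data.Fin using (Fin)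
open import Data.Fin.Subset using (Subset; _∈_; _∉_; _∪_; ⁅_⁆)
open import Data.Fin.Subset.Properties using (_∈?_)
open import Data.Fin.Properties using (all?)
open import Data.Vec using ([]; _∷_)
open import Data.List using (List; []; _∷_; map; _++_; filter; length)
open import Data.Sum using (_⊎_; inj₁; inj₂)
open import Data.Product using (_×_; _,_)
open import Data.Empty using (⊥)
open import Relation.Nullary using (¬_; Dec; yes; no; _×-dec_; _→-dec_; ¬?)
open import Relation.Binary.PropositionalEquality using (_≡_)
open import Data.Bool.Properties using () renaming (_≟_ to _≟B_)
open import Function.Definitions using (Injective)
import Data.Rational as ℚ
import Data.Integer as ℤ
open ℚ using (ℚ)

record Graph (n : ℕ) : Set where
  field
    adj   : Fin n → Fin n → Bool
    sym   : ∀ i j → adj i j ≡ adj j i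
    irrefl : ∀ i → adj i i ≡ false

open Graph public

Adjacent : ∀ {n} → Graph n → Fin n → Fin n → Set
Adjacent G i j = adj G i j ≡ true

adjacent? : ∀ {n} (G : Graph n) i j → Dec (Adjacent G i j)
adjacent? G i j = adj G i j ≟B true

TriangleFree : ∀ {n} → Graph n → Set
TriangleFree {n} G =
  ∀ (i j k : Fin n) → Adjacent G i j → Adjacent G j k → Adjacent G i k → ⊥

-- Induced matchings of size s: edges (f a, g a) for a : Fin s, all 2s
-- endpoints distinct, and the only edges among the endpoints are the
-- matching edges.

endpoint : ∀ {n s} → (Fin s → Fin n) → (Fin s → Fin n) → Fin s ⊎ Fin s → Fin n
endpoint f g (inj₁ a) = f a
endpoint f g (inj₂ a) = g a

edgeIndex : ∀ {s} → Fin s ⊎ Fin s → Fin s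
edgeIndex (inj₁ a) = a
edgeIndex (inj₂ a) = a

record InducedMatching {n} (G : Graph n) (s : ℕ) : Set where
  field
    left right : Fin s → Fin n
    isEdge     : ∀ a → Adjacent G (left a) (right a)
    distinct   : Injective _≡_ _≡_ (endpoint left right)
    induced    : ∀ x y → Adjacent G (endpoint left right x) (endpoint left right y)
                   → edgeIndex x ≡ edgeIndex y

Independent : ∀ {n} → Graph n → Subset n → Set
Independent {n} G S = ∀ (i j : Fin n) → i ∈ S → j ∈ S → ¬ Adjacent G i j

MaximalIndependent : ∀ {n} → Graph n → Subset n → Set
MaximalIndependent {n} G S =
  Independent G S × (∀ (v : Fin n) → v ∉ S → ¬ Independent G (S ∪ ⁅ v ⁆))

independent? : ∀ {n} (G : Graph n) S → Dec (Independent G S)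
independent? G S =
  all? λ i → all? λ j → (i ∈? S) →-dec ((j ∈? S) →-dec ¬? (adjacent? G i j))

maximalIndependent? : ∀ {n} (G : Graph n) S → Dec (MaximalIndependent G S)
maximalIndependent? G S =
  independent? G S ×-dec
  (all? λ v → ¬? (v ∈? S) →-dec ¬? (independent? G (S ∪ ⁅ v ⁆)))

allSubsets : (n : ℕ) → List (Subset n)
allSubsets zero = [] ∷ []
allSubsets (suc n) = map (true ∷_) (allSubsets n) ++ map (false ∷_) (allSubsets n)

mis : ∀ {n} → Graph n → ℕ
mis {n} G = length (filter (maximalIndependent? G) (allSubsets n))

nℚ : ℕ → ℚ
nℚ m = ℤ.+ m ℚ./ 1

_^ℚ_ : ℚ → ℕ → ℚ
x ^ℚ zero = ℚ.1ℚ
x ^ℚ suc k = x ℚ.* (x ^ℚ k)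

pc : ℚ → ℚ
pc x = x ^ℚ 6 ℚ.- (nℚ 2 ℚ.* (x ^ℚ 2)) ℚ.- (nℚ 2 ℚ.* x) ℚ.- ℚ.1ℚ

-- For rational x > 0:  x > c  ⇔  p(x) > 0,  and  x < c  ⇔  p(x) < 0
-- (p has exactly one positive real root, namely c).
AboveC : ℚ → Set
AboveC x = (ℚ.0ℚ ℚ.< x) × (ℚ.0ℚ ℚ.< pc x)

BelowC : ℚ → Set
BelowC x = (ℚ.0ℚ ℚ.< x) × (pc x ℚ.< ℚ.0ℚ)

-- "m ≤ 2^t · c^(n-2t)" (integer exponent n - 2t, possibly negative),
-- expressed through rational approximations of c from the correct side:
--  * if 2t ≤ n: m ≤ 2^t x^(n-2t) for every rational x > c;
--  * if n ≤ 2t: m · x^(2t-n) ≤ 2^t for every rational 0 < x < c.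
-- By continuity each is equivalent to the real inequality.
BoundedBy2^tc^[n-2t] : ℕ → ℕ → ℕ → Set
BoundedBy2^tc^[n-2t] m n t =
  (2 ℕ.* t ℕ.≤ n → ∀ (x : ℚ) → AboveC x →
      nℚ m ℚ.≤ nℚ (2 ℕ.^ t) ℚ.* (x ^ℚ (n ℕ.∸ 2 ℕ.* t)))
  ×
  (n ℕ.≤ 2 ℕ.* t → ∀ (x : ℚ) → BelowC x →
      nℚ m ℚ.* (x ^ℚ (2 ℕ.* t ℕ.∸ n)) ℚ.≤ nℚ (2 ℕ.^ t))

module Submission where

-- Fix a rational x with 7/5 ≤ x and x² ≤ 2; such x approximate c = 1.4075… from both sides. By
-- induction on |W|, the induced subgraph G[W] has at most 2^t x^(|W| − 2t) maximal independent
-- sets when it has no induced matching of size t + 1. Every maximal independent set S of G[W]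
-- either contains a vertex v, and then S − v is maximal in G[W − N[v]], or misses it, and then S is
-- maximal in G[W − v]; if v is pendant with neighbour u, S contains v or u. If W′ ⊆ W avoids the
-- closed neighbourhoods of both ends of an edge of G[W], every induced matching of G[W′] extends
-- by that edge, so t drops by one on W′. A vertex of degree ≥ 3 then leads to x³ + 1 ≤ x⁴, a
-- pendant vertex to 2x + x² ≤ 2x³, and a 2-regular G[W] (where deleting a vertex leaves a pendant
-- path) to 4x + x² ≤ 2x⁴; all three hold for x ≥ 7/5, while x² ≤ 2 settles the empty graph.

open import Data.Product using (Σ-syntax; _×_; _,_; proj₁; proj₂; map₁; map₂; ∃-syntax)
open import Data.Sum as Sum using (_⊎_; inj₁; inj₂)
open import Relation.Binary.PropositionalEquality
open import Relation.Nullary using (¬_; Dec; yes; no; contradiction; ¬?; _×-dec_; _→-dec_)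

open import Defs hiding (sym)

module Bounds where
  open import Data.Nat as ℕ using (ℕ; zero; suc)
  import Data.Nat.Properties as ℕ
  import Data.Integer as ℤ
  import Data.Integer.Properties as ℤ
  open import Data.Nat.Coprimality using (1-coprimeTo) renaming (sym to coprime-sym)
  open import Data.Bool using (T)
  open import Data.Rational
    using (ℚ; mkℚ; _/_; _+_; _*_; _-_; -_; _≤_; _<_; _≤ᵇ_; *≤*; 0ℚ; 1ℚ; nonNegative; positive)
  open import Data.Rational.Properties
  open import Data.Rational.Solver using (module +-*-Solver)
  open +-*-Solver

  nℚ≡mkℚ : ∀ m → nℚ m ≡ mkℚ (ℤ.+ m) 0 (coprime-sym (1-coprimeTo m))
  nℚ≡mkℚ m = normalize-coprime (coprime-sym (1-coprimeTo m))

  nℚ-homo-+ : ∀ a b → nℚ (a ℕ.+ b) ≡ nℚ a + nℚ b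
  nℚ-homo-+ a b rewrite nℚ≡mkℚ a | nℚ≡mkℚ b =
    cong₂ (λ p q → (p ℤ.+ q) / 1) (sym (ℤ.*-identityʳ (ℤ.+ a))) (sym (ℤ.*-identityʳ (ℤ.+ b)))

  nℚ-homo-* : ∀ a b → nℚ (a ℕ.* b) ≡ nℚ a * nℚ b
  nℚ-homo-* a b rewrite nℚ≡mkℚ a | nℚ≡mkℚ b = cong (_/ 1) (sym (ℤ.+◃n≡+n (a ℕ.* b)))

  nℚ-mono-≤ : ∀ {a b} → a ℕ.≤ b → nℚ a ≤ nℚ b
  nℚ-mono-≤ {a} {b} a≤b rewrite nℚ≡mkℚ a | nℚ≡mkℚ b =
    *≤* (subst₂ ℤ._≤_ (sym (ℤ.*-identityʳ (ℤ.+ a))) (sym (ℤ.*-identityʳ (ℤ.+ b))) (ℤ.+≤+ a≤b))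

  0≤nℚ : ∀ a → 0ℚ ≤ nℚ a
  0≤nℚ a = nℚ-mono-≤ {0} {a} ℕ.z≤n

  *-monoˡ-≤-0≤ : ∀ {r p q} → 0ℚ ≤ r → p ≤ q → r * p ≤ r * q
  *-monoˡ-≤-0≤ {r} 0≤r = *-monoˡ-≤-nonNeg r {{nonNegative 0≤r}}

  *-monoʳ-≤-0≤ : ∀ {r p q} → 0ℚ ≤ r → p ≤ q → p * r ≤ q * r
  *-monoʳ-≤-0≤ {r} 0≤r = *-monoʳ-≤-nonNeg r {{nonNegative 0≤r}}

  *-mono-≤-0≤ : ∀ {p q r s} → 0ℚ ≤ p → 0ℚ ≤ r → p ≤ q → r ≤ s → p * r ≤ q * s
  *-mono-≤-0≤ 0≤p 0≤r p≤q r≤s = ≤-trans (*-monoʳ-≤-0≤ 0≤r p≤q) (*-monoˡ-≤-0≤ (≤-trans 0≤p p≤q) r≤s)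

  0≤* : ∀ {p q} → 0ℚ ≤ p → 0ℚ ≤ q → 0ℚ ≤ p * q
  0≤* {p} 0≤p 0≤q = subst (_≤ p * _) (*-zeroʳ p) (*-monoˡ-≤-0≤ 0≤p 0≤q)

  0≤horner : ∀ c {e p} {_ : T (0ℚ ≤ᵇ c)} → 0ℚ ≤ e → 0ℚ ≤ p → 0ℚ ≤ c + e * p
  0≤horner c {_} {_} {0≤ᵇc} 0≤e 0≤p = +-mono-≤ 0≤c (0≤* 0≤e 0≤p)
    where
    0≤c : 0ℚ ≤ c
    0≤c = ≤ᵇ⇒≤ 0≤ᵇc

  ≤-by-difference : ∀ {p q d} → 0ℚ ≤ d → q ≡ p + d → p ≤ q
  ≤-by-difference {p} 0≤d q≡p+d = subst₂ _≤_ (+-identityʳ p) (sym q≡p+d) (+-monoʳ-≤ p 0≤d)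

  0≤q-p : ∀ {p q} → p ≤ q → 0ℚ ≤ q - p
  0≤q-p {p} {q} p≤q = subst (_≤ q - p) (+-inverseʳ p) (+-monoˡ-≤ (- p) p≤q)

  ^ℚ-+ : ∀ x a b → x ^ℚ (a ℕ.+ b) ≡ x ^ℚ a * x ^ℚ b
  ^ℚ-+ x zero    b = sym (*-identityˡ (x ^ℚ b))
  ^ℚ-+ x (suc a) b = trans (cong (x *_) (^ℚ-+ x a b)) (sym (*-assoc x (x ^ℚ a) (x ^ℚ b)))

  0≤^ℚ : ∀ {x} → 0ℚ ≤ x → ∀ k → 0ℚ ≤ x ^ℚ k
  0≤^ℚ 0≤x zero    = ≤ᵇ⇒≤ _
  0≤^ℚ 0≤x (suc k) = 0≤* 0≤x (0≤^ℚ 0≤x k)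

  0<^ℚ : ∀ {x} → 0ℚ < x → ∀ k → 0ℚ < x ^ℚ k
  0<^ℚ 0<x zero    = positive⁻¹ 1ℚ
  0<^ℚ {x} 0<x (suc k) =
    subst (_< x * x ^ℚ k) (*-zeroˡ (x ^ℚ k)) (*-monoˡ-<-pos (x ^ℚ k) {{positive (0<^ℚ 0<x k)}} 0<x)

  ^ℚ-monoˡ-≤ : ∀ {x y} → 0ℚ ≤ x → x ≤ y → ∀ k → x ^ℚ k ≤ y ^ℚ k
  ^ℚ-monoˡ-≤ 0≤x x≤y zero    = ≤-refl
  ^ℚ-monoˡ-≤ 0≤x x≤y (suc k) = *-mono-≤-0≤ 0≤x (0≤^ℚ 0≤x k) x≤y (^ℚ-monoˡ-≤ 0≤x x≤y k)

  1≤^ℚ : ∀ {x} → 1ℚ ≤ x → ∀ k → 1ℚ ≤ x ^ℚ k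
  1≤^ℚ 1≤x zero    = ≤-refl
  1≤^ℚ 1≤x (suc k) = *-mono-≤-0≤ (≤ᵇ⇒≤ _) (≤ᵇ⇒≤ _) 1≤x (1≤^ℚ 1≤x k)

  ^ℚ-monoʳ-≤ : ∀ {x} → 1ℚ ≤ x → ∀ {a b} → a ℕ.≤ b → x ^ℚ a ≤ x ^ℚ b
  ^ℚ-monoʳ-≤ {x} 1≤x {a} {b} a≤b = begin
    x ^ℚ a                        ≡⟨ *-identityʳ (x ^ℚ a) ⟨
    x ^ℚ a * 1ℚ                   ≤⟨ *-monoˡ-≤-0≤ (0≤^ℚ 0≤x a) (1≤^ℚ 1≤x (b ℕ.∸ a)) ⟩
    x ^ℚ a * x ^ℚ (b ℕ.∸ a)       ≡⟨ ^ℚ-+ x a (b ℕ.∸ a) ⟨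
    x ^ℚ (a ℕ.+ (b ℕ.∸ a))        ≡⟨ cong (x ^ℚ_) (ℕ.m+[n∸m]≡n a≤b) ⟩
    x ^ℚ b                        ∎
    where
    open ≤-Reasoning
    0≤x = ≤-trans (≤ᵇ⇒≤ _) 1≤x

  7/5 : ℚ
  7/5 = ℤ.+ 7 / 5

  Admissible : ℚ → Set
  Admissible x = 7/5 ≤ x × x * x ≤ nℚ 2

  admissible-7/5 : Admissible 7/5
  admissible-7/5 = ≤-refl , ≤ᵇ⇒≤ _

  -- Expanded around 7/5, each of these differences has nonnegative coefficients.
  module _ {x : ℚ} (7/5≤x : 7/5 ≤ x) where
    private
      0≤x : 0ℚ ≤ x
      0≤x = ≤-trans (≤ᵇ⇒≤ _) 7/5≤x
      0≤x-7/5 : 0ℚ ≤ x - 7/5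
      0≤x-7/5 = 0≤q-p 7/5≤x

    2x+x²≤2x³ : nℚ 2 * x + x * x ≤ nℚ 2 * (x * (x * x))
    2x+x²≤2x³ = ≤-by-difference 0≤d eq
      where
      d : ℚ
      d = x * (ℤ.+ 13 / 25 + (x - 7/5) * (ℤ.+ 23 / 5 + (x - 7/5) * nℚ 2))
      0≤d : 0ℚ ≤ d
      0≤d = 0≤* 0≤x (0≤horner (ℤ.+ 13 / 25) 0≤x-7/5 (0≤horner (ℤ.+ 23 / 5) 0≤x-7/5 (≤ᵇ⇒≤ _)))
      eq : nℚ 2 * (x * (x * x)) ≡ (nℚ 2 * x + x * x) + d
      eq = solve 1 (λ x → con (nℚ 2) :* (x :* (x :* x)) :=
                          (con (nℚ 2) :* x :+ x :* x)
                          :+ x :* (con (ℤ.+ 13 / 25) :+ (x :- con 7/5) :* (con (ℤ.+ 23 / 5) :+ (x :- con 7/5) :* con (nℚ 2))))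
                 refl x

    x³+1≤x⁴ : x * (x * x) + 1ℚ ≤ x * (x * (x * x))
    x³+1≤x⁴ = ≤-by-difference 0≤d eq
      where
      d : ℚ
      d = ℤ.+ 61 / 625 + (x - 7/5) * (ℤ.+ 637 / 125 + (x - 7/5) * (ℤ.+ 189 / 25 + (x - 7/5) * (ℤ.+ 23 / 5 + (x - 7/5) * 1ℚ)))
      0≤d : 0ℚ ≤ d
      0≤d = 0≤horner (ℤ.+ 61 / 625) 0≤x-7/5 (0≤horner (ℤ.+ 637 / 125) 0≤x-7/5
              (0≤horner (ℤ.+ 189 / 25) 0≤x-7/5 (0≤horner (ℤ.+ 23 / 5) 0≤x-7/5 (≤ᵇ⇒≤ _))))
      eq : x * (x * (x * x)) ≡ (x * (x * x) + 1ℚ) + d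
      eq = solve 1 (λ x → x :* (x :* (x :* x)) :=
                          (x :* (x :* x) :+ con 1ℚ)
                          :+ (con (ℤ.+ 61 / 625) :+ (x :- con 7/5) :* (con (ℤ.+ 637 / 125) :+ (x :- con 7/5)
                              :* (con (ℤ.+ 189 / 25) :+ (x :- con 7/5) :* (con (ℤ.+ 23 / 5) :+ (x :- con 7/5) :* con 1ℚ)))))
                 refl x

    4x+x²≤2x⁴ : nℚ 4 * x + x * x ≤ nℚ 2 * (x * (x * (x * x)))
    4x+x²≤2x⁴ = ≤-by-difference 0≤d eq
      where
      d : ℚ
      d = x * (ℤ.+ 11 / 125 + (x - 7/5) * (ℤ.+ 269 / 25 + (x - 7/5) * (ℤ.+ 42 / 5 + (x - 7/5) * nℚ 2)))
      0≤d : 0ℚ ≤ d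
      0≤d = 0≤* 0≤x (0≤horner (ℤ.+ 11 / 125) 0≤x-7/5 (0≤horner (ℤ.+ 269 / 25) 0≤x-7/5
              (0≤horner (ℤ.+ 42 / 5) 0≤x-7/5 (≤ᵇ⇒≤ _))))
      eq : nℚ 2 * (x * (x * (x * x))) ≡ (nℚ 4 * x + x * x) + d
      eq = solve 1 (λ x → con (nℚ 2) :* (x :* (x :* (x :* x))) :=
                          (con (nℚ 4) :* x :+ x :* x)
                          :+ x :* (con (ℤ.+ 11 / 125) :+ (x :- con 7/5) :* (con (ℤ.+ 269 / 25) :+ (x :- con 7/5)
                                   :* (con (ℤ.+ 42 / 5) :+ (x :- con 7/5) :* con (nℚ 2)))))
                 refl x

  -- m ≤ 2^t · x^(k − 2t), stated without negative exponents.
  record Bounded (x : ℚ) (m k t : ℕ) : Set where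
    constructor bounded
    field bound : nℚ m * x ^ℚ (2 ℕ.* t) ≤ nℚ (2 ℕ.^ t) * x ^ℚ k

  module Recurrences {x : ℚ} (admissible : Admissible x) where
    private
      7/5≤x : 7/5 ≤ x
      7/5≤x = proj₁ admissible
      0≤x : 0ℚ ≤ x
      0≤x = ≤-trans (≤ᵇ⇒≤ _) 7/5≤x
      0≤x² : 0ℚ ≤ x * x
      0≤x² = 0≤* 0≤x 0≤x
      0≤2^t·x^k : ∀ t k → 0ℚ ≤ nℚ (2 ℕ.^ t) * x ^ℚ k
      0≤2^t·x^k t k = 0≤* (0≤nℚ (2 ℕ.^ t)) (0≤^ℚ 0≤x k)
      x^[2+2t] : ∀ t → x ^ℚ (2 ℕ.* suc t) ≡ x * (x * x ^ℚ (2 ℕ.* t))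
      x^[2+2t] t = cong (x ^ℚ_) (ℕ.*-suc 2 t)
      2^[1+t] : ∀ t → nℚ (2 ℕ.^ suc t) ≡ nℚ 2 * nℚ (2 ℕ.^ t)
      2^[1+t] t = nℚ-homo-* 2 (2 ℕ.^ t)

      bound-suc : ∀ {m k t} → Bounded x m (1 ℕ.+ k) (suc t) →
                  nℚ m * (x * (x * x ^ℚ (2 ℕ.* t))) ≤ (nℚ 2 * nℚ (2 ℕ.^ t)) * (x * x ^ℚ k)
      bound-suc {m} {k} {t} (bounded b) =
        subst₂ _≤_ (cong (nℚ m *_) (x^[2+2t] t)) (cong (_* (x * x ^ℚ k)) (2^[1+t] t)) b

    x^2t≤2^t : ∀ t → x ^ℚ (2 ℕ.* t) ≤ nℚ (2 ℕ.^ t)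
    x^2t≤2^t zero    = ≤-refl
    x^2t≤2^t (suc t) = begin
      x ^ℚ (2 ℕ.* suc t)      ≡⟨ trans (x^[2+2t] t) (sym (*-assoc x x _)) ⟩
      x * x * x ^ℚ (2 ℕ.* t)  ≤⟨ *-mono-≤-0≤ 0≤x² (0≤^ℚ 0≤x (2 ℕ.* t)) (proj₂ admissible) (x^2t≤2^t t) ⟩
      nℚ 2 * nℚ (2 ℕ.^ t)     ≡⟨ 2^[1+t] t ⟨
      nℚ (2 ℕ.^ suc t)        ∎
      where open ≤-Reasoning

    bounded-1 : ∀ {t} → Bounded x 1 0 t
    bounded-1 {t} = bounded (begin
      nℚ 1 * x ^ℚ (2 ℕ.* t)  ≡⟨ *-identityˡ _ ⟩
      x ^ℚ (2 ℕ.* t)         ≤⟨ x^2t≤2^t t ⟩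
      nℚ (2 ℕ.^ t)           ≡⟨ *-identityʳ _ ⟨
      nℚ (2 ℕ.^ t) * 1ℚ      ∎)
      where open ≤-Reasoning

    bounded-≤ : ∀ {m m′ k t} → m′ ℕ.≤ m → Bounded x m k t → Bounded x m′ k t
    bounded-≤ {t = t} m′≤m (bounded b) =
      bounded (≤-trans (*-monoʳ-≤-0≤ (0≤^ℚ 0≤x (2 ℕ.* t)) (nℚ-mono-≤ m′≤m)) b)

    bounded-size-≤ : ∀ {m k k′ t} → k ℕ.≤ k′ → Bounded x m k t → Bounded x m k′ t
    bounded-size-≤ {t = t} k≤k′ (bounded b) =
      bounded (≤-trans b (*-monoˡ-≤-0≤ (0≤nℚ (2 ℕ.^ t)) (^ℚ-monoʳ-≤ (≤-trans (≤ᵇ⇒≤ _) 7/5≤x) k≤k′)))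

    bounded-isolatedEdge : ∀ {a b k t} → Bounded x a k t → Bounded x b k t →
                           Bounded x (a ℕ.+ b) (2 ℕ.+ k) (suc t)
    bounded-isolatedEdge {a} {b} {k} {t} (bounded ba) (bounded bb) = bounded (begin
      nℚ (a ℕ.+ b) * x ^ℚ (2 ℕ.* suc t)  ≡⟨ cong₂ _*_ (nℚ-homo-+ a b) (x^[2+2t] t) ⟩
      (A + B) * (x * (x * X))            ≡⟨ solve 4 (λ A B x X → (A :+ B) :* (x :* (x :* X))
                                                            := (x :* x) :* (A :* X :+ B :* X)) refl A B x X ⟩
      (x * x) * (A * X + B * X)          ≤⟨ *-monoˡ-≤-0≤ 0≤x² (+-mono-≤ ba bb) ⟩
      (x * x) * (P * Y + P * Y)          ≡⟨ solve 3 (λ x P Y → (x :* x) :* (P :* Y :+ P :* Y)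
                                                          := (con (nℚ 2) :* P) :* (x :* (x :* Y))) refl x P Y ⟩
      (nℚ 2 * P) * (x * (x * Y))         ≡⟨ cong (_* (x * (x * Y))) (2^[1+t] t) ⟨
      nℚ (2 ℕ.^ suc t) * x ^ℚ (2 ℕ.+ k)  ∎)
      where
      open ≤-Reasoning
      A B X P Y : ℚ
      A = nℚ a
      B = nℚ b
      X = x ^ℚ (2 ℕ.* t)
      P = nℚ (2 ℕ.^ t)
      Y = x ^ℚ k

    bounded-pendant : ∀ {a b k t} → Bounded x a (1 ℕ.+ k) (suc t) → Bounded x b k t →
                      Bounded x (a ℕ.+ b) (3 ℕ.+ k) (suc t)
    bounded-pendant {a} {b} {k} {t} ba (bounded bb) = bounded (begin
      nℚ (a ℕ.+ b) * x ^ℚ (2 ℕ.* suc t)         ≡⟨ cong₂ _*_ (nℚ-homo-+ a b) (x^[2+2t] t) ⟩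
      (A + B) * (x * (x * X))                   ≡⟨ solve 4 (λ A B x X → (A :+ B) :* (x :* (x :* X))
                                                                   := A :* (x :* (x :* X)) :+ (x :* x) :* (B :* X))
                                                           refl A B x X ⟩
      A * (x * (x * X)) + (x * x) * (B * X)     ≤⟨ +-mono-≤ (bound-suc ba) (*-monoˡ-≤-0≤ 0≤x² bb) ⟩
      (nℚ 2 * P) * (x * Y) + (x * x) * (P * Y)  ≡⟨ solve 3 (λ x P Y → (con (nℚ 2) :* P) :* (x :* Y) :+ (x :* x) :* (P :* Y)
                                                                 := (P :* Y) :* (con (nℚ 2) :* x :+ x :* x))
                                                           refl x P Y ⟩
      (P * Y) * (nℚ 2 * x + x * x)              ≤⟨ *-monoˡ-≤-0≤ (0≤2^t·x^k t k) (2x+x²≤2x³ 7/5≤x) ⟩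
      (P * Y) * (nℚ 2 * (x * (x * x)))          ≡⟨ solve 3 (λ x P Y → (P :* Y) :* (con (nℚ 2) :* (x :* (x :* x)))
                                                                 := (con (nℚ 2) :* P) :* (x :* (x :* (x :* Y))))
                                                           refl x P Y ⟩
      (nℚ 2 * P) * (x * (x * (x * Y)))          ≡⟨ cong (_* (x * (x * (x * Y)))) (2^[1+t] t) ⟨
      nℚ (2 ℕ.^ suc t) * x ^ℚ (3 ℕ.+ k)         ∎)
      where
      open ≤-Reasoning
      A B X P Y : ℚ
      A = nℚ a
      B = nℚ b
      X = x ^ℚ (2 ℕ.* t)
      P = nℚ (2 ℕ.^ t)
      Y = x ^ℚ k

    bounded-highDegree : ∀ {a b k t} → Bounded x a k t → Bounded x b (3 ℕ.+ k) t →
                         Bounded x (a ℕ.+ b) (4 ℕ.+ k) t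
    bounded-highDegree {a} {b} {k} {t} (bounded ba) (bounded bb) = bounded (begin
      nℚ (a ℕ.+ b) * X                 ≡⟨ cong (_* X) (nℚ-homo-+ a b) ⟩
      (A + B) * X                      ≡⟨ *-distribʳ-+ X A B ⟩
      A * X + B * X                    ≤⟨ +-mono-≤ ba bb ⟩
      P * Y + P * (x * (x * (x * Y)))  ≡⟨ solve 3 (λ x P Y → P :* Y :+ P :* (x :* (x :* (x :* Y)))
                                                        := (P :* Y) :* (x :* (x :* x) :+ con 1ℚ)) refl x P Y ⟩
      (P * Y) * (x * (x * x) + 1ℚ)     ≤⟨ *-monoˡ-≤-0≤ (0≤2^t·x^k t k) (x³+1≤x⁴ 7/5≤x) ⟩
      (P * Y) * (x * (x * (x * x)))    ≡⟨ solve 3 (λ x P Y → (P :* Y) :* (x :* (x :* (x :* x)))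
                                                        := P :* (x :* (x :* (x :* (x :* Y))))) refl x P Y ⟩
      P * x ^ℚ (4 ℕ.+ k)               ∎)
      where
      open ≤-Reasoning
      A B X P Y : ℚ
      A = nℚ a
      B = nℚ b
      X = x ^ℚ (2 ℕ.* t)
      P = nℚ (2 ℕ.^ t)
      Y = x ^ℚ k

    bounded-cycle : ∀ {a b c k t} → Bounded x a (1 ℕ.+ k) (suc t) → Bounded x b (1 ℕ.+ k) (suc t) →
                    Bounded x c k t → Bounded x (a ℕ.+ (b ℕ.+ c)) (4 ℕ.+ k) (suc t)
    bounded-cycle {a} {b} {c} {k} {t} ba bb (bounded bc) = bounded (begin
      nℚ (a ℕ.+ (b ℕ.+ c)) * x ^ℚ (2 ℕ.* suc t)
        ≡⟨ cong₂ _*_ (trans (nℚ-homo-+ a (b ℕ.+ c)) (cong (A +_) (nℚ-homo-+ b c))) (x^[2+2t] t) ⟩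
      (A + (B + C)) * (x * (x * X))
        ≡⟨ solve 5 (λ A B C x X → (A :+ (B :+ C)) :* (x :* (x :* X))
                                := A :* (x :* (x :* X)) :+ B :* (x :* (x :* X)) :+ (x :* x) :* (C :* X))
                   refl A B C x X ⟩
      A * (x * (x * X)) + B * (x * (x * X)) + (x * x) * (C * X)
        ≤⟨ +-mono-≤ (+-mono-≤ (bound-suc ba) (bound-suc bb)) (*-monoˡ-≤-0≤ 0≤x² bc) ⟩
      (nℚ 2 * P) * (x * Y) + (nℚ 2 * P) * (x * Y) + (x * x) * (P * Y)
        ≡⟨ solve 3 (λ x P Y → (con (nℚ 2) :* P) :* (x :* Y) :+ (con (nℚ 2) :* P) :* (x :* Y) :+ (x :* x) :* (P :* Y)
                            := (P :* Y) :* (con (nℚ 4) :* x :+ x :* x))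
                   refl x P Y ⟩
      (P * Y) * (nℚ 4 * x + x * x)
        ≤⟨ *-monoˡ-≤-0≤ (0≤2^t·x^k t k) (4x+x²≤2x⁴ 7/5≤x) ⟩
      (P * Y) * (nℚ 2 * (x * (x * (x * x))))
        ≡⟨ solve 3 (λ x P Y → (P :* Y) :* (con (nℚ 2) :* (x :* (x :* (x :* x))))
                            := (con (nℚ 2) :* P) :* (x :* (x :* (x :* (x :* Y)))))
                   refl x P Y ⟩
      (nℚ 2 * P) * (x * (x * (x * (x * Y))))
        ≡⟨ cong (_* (x * (x * (x * (x * Y))))) (2^[1+t] t) ⟨
      nℚ (2 ℕ.^ suc t) * x ^ℚ (4 ℕ.+ k) ∎)
      where
      open ≤-Reasoning
      A B C X P Y : ℚ
      A = nℚ a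
      B = nℚ b
      C = nℚ c
      X = x ^ℚ (2 ℕ.* t)
      P = nℚ (2 ℕ.^ t)
      Y = x ^ℚ k

  pc<0 : ∀ {x} → 0ℚ < x → x ≤ 7/5 → pc x < 0ℚ
  pc<0 {x} 0<x x≤7/5 = subst₂ _<_ (+-identityʳ (pc x)) pc+S≡0 (+-monoʳ-< (pc x) 0<S)
    where
    0≤x : 0ℚ ≤ x
    0≤x = <⇒≤ 0<x
    T₁ T₂ T₃ c₁ c₂ c₃ S : ℚ
    T₁ = x ^ℚ 2 * 7/5 ^ℚ 4 - x ^ℚ 6
    T₂ = 7/5 * x - x * x
    T₃ = 7/5 - x
    c₁ = ℤ.+ 1151 / 625
    c₂ = ℤ.+ 1807 / 3125
    c₃ = ℤ.+ 2976 / 15625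
    S = T₁ + c₁ * T₂ + c₂ * T₃ + c₃
    0≤T₁ : 0ℚ ≤ T₁
    0≤T₁ = 0≤q-p (subst (_≤ x ^ℚ 2 * 7/5 ^ℚ 4) (sym (^ℚ-+ x 2 4))
                        (*-monoˡ-≤-0≤ (0≤^ℚ 0≤x 2) (^ℚ-monoˡ-≤ 0≤x x≤7/5 4)))
    0<S : 0ℚ < S
    0<S = +-mono-≤-< (+-mono-≤ (+-mono-≤ 0≤T₁ (0≤* 0≤c₁ (0≤q-p (*-monoʳ-≤-0≤ 0≤x x≤7/5))))
                               (0≤* 0≤c₂ (0≤q-p x≤7/5)))
                     (positive⁻¹ c₃)
      where
      0≤c₁ : 0ℚ ≤ c₁
      0≤c₁ = ≤ᵇ⇒≤ _
      0≤c₂ : 0ℚ ≤ c₂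
      0≤c₂ = ≤ᵇ⇒≤ _
    pc+S≡0 : pc x + S ≡ 0ℚ
    pc+S≡0 = solve 1 (λ x →
       ((x :* (x :* (x :* (x :* (x :* (x :* con 1ℚ)))))) :- (con (nℚ 2) :* (x :* (x :* con 1ℚ))) :- (con (nℚ 2) :* x) :- con 1ℚ)
       :+ (((x :* (x :* con 1ℚ)) :* (con 7/5 :* (con 7/5 :* (con 7/5 :* (con 7/5 :* con 1ℚ))))
            :- (x :* (x :* (x :* (x :* (x :* (x :* con 1ℚ)))))))
           :+ con (ℤ.+ 1151 / 625) :* (con 7/5 :* x :- x :* x)
           :+ con (ℤ.+ 1807 / 3125) :* (con 7/5 :- x)
           :+ con (ℤ.+ 2976 / 15625))
       := con 0ℚ) refl x

  0<pc : ∀ {x} → 7/5 ≤ x → nℚ 2 ≤ x * x → 0ℚ < pc x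
  0<pc {x} 7/5≤x 2≤x² = subst (0ℚ <_) (sym pc≡) (+-mono-≤-< 0≤s³-4s (+-mono-<-≤ (positive⁻¹ _) 0≤rest))
    where
    s : ℚ
    s = x * x
    0≤x : 0ℚ ≤ x
    0≤x = ≤-trans (≤ᵇ⇒≤ _) 7/5≤x
    0≤s³-4s : 0ℚ ≤ s * (s * s) - s * (nℚ 2 * nℚ 2)
    0≤s³-4s = 0≤q-p (*-monoˡ-≤-0≤ (0≤* 0≤x 0≤x) (*-mono-≤-0≤ (0≤nℚ 2) (0≤nℚ 2) 2≤x² 2≤x²))
    0≤rest : 0ℚ ≤ (x - 7/5) * (ℤ.+ 18 / 5 + (x - 7/5) * nℚ 2)
    0≤rest = 0≤* (0≤q-p 7/5≤x) (0≤horner (ℤ.+ 18 / 5) (0≤q-p 7/5≤x) (0≤nℚ 2))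
    pc≡ : pc x ≡ (s * (s * s) - s * (nℚ 2 * nℚ 2)) + (ℤ.+ 3 / 25 + (x - 7/5) * (ℤ.+ 18 / 5 + (x - 7/5) * nℚ 2))
    pc≡ = solve 1 (λ x →
       ((x :* (x :* (x :* (x :* (x :* (x :* con 1ℚ)))))) :- (con (nℚ 2) :* (x :* (x :* con 1ℚ))) :- (con (nℚ 2) :* x) :- con 1ℚ)
       := ((x :* x) :* ((x :* x) :* (x :* x)) :- (x :* x) :* (con (nℚ 2) :* con (nℚ 2)))
          :+ (con (ℤ.+ 3 / 25) :+ (x :- con 7/5) :* (con (ℤ.+ 18 / 5) :+ (x :- con 7/5) :* con (nℚ 2)))) refl x

  module _ {m n t : ℕ} {y : ℚ} (0<y : 0ℚ < y) (bnd : Bounded y m n t) where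
    private
      open Bounded bnd
      P : ℚ
      P = nℚ (2 ℕ.^ t)

    bounded⇒m≤2^t·y^[n-2t] : 2 ℕ.* t ℕ.≤ n → nℚ m ≤ nℚ (2 ℕ.^ t) * y ^ℚ (n ℕ.∸ 2 ℕ.* t)
    bounded⇒m≤2^t·y^[n-2t] 2t≤n =
      *-cancelʳ-≤-pos X {{positive (0<^ℚ 0<y (2 ℕ.* t))}} (subst (nℚ m * X ≤_) eq bound)
      where
      X : ℚ
      X = y ^ℚ (2 ℕ.* t)
      r : ℕ
      r = n ℕ.∸ 2 ℕ.* t
      eq : P * y ^ℚ n ≡ (P * y ^ℚ r) * X
      eq = begin
        P * y ^ℚ n               ≡⟨ cong (λ e → P * y ^ℚ e) (ℕ.m+[n∸m]≡n 2t≤n) ⟨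
        P * y ^ℚ (2 ℕ.* t ℕ.+ r) ≡⟨ cong (P *_) (^ℚ-+ y (2 ℕ.* t) r) ⟩
        P * (X * y ^ℚ r)         ≡⟨ solve 3 (λ P X Y → P :* (X :* Y) := (P :* Y) :* X) refl P X (y ^ℚ r) ⟩
        (P * y ^ℚ r) * X         ∎
        where open ≡-Reasoning

    bounded⇒m·y^[2t-n]≤2^t : n ℕ.≤ 2 ℕ.* t → nℚ m * y ^ℚ (2 ℕ.* t ℕ.∸ n) ≤ nℚ (2 ℕ.^ t)
    bounded⇒m·y^[2t-n]≤2^t n≤2t = *-cancelʳ-≤-pos Y {{positive (0<^ℚ 0<y n)}} (subst (_≤ P * Y) eq bound)
      where
      Y : ℚ
      Y = y ^ℚ n
      r : ℕ
      r = 2 ℕ.* t ℕ.∸ n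
      eq : nℚ m * y ^ℚ (2 ℕ.* t) ≡ (nℚ m * y ^ℚ r) * Y
      eq = begin
        nℚ m * y ^ℚ (2 ℕ.* t)   ≡⟨ cong (λ e → nℚ m * y ^ℚ e) (ℕ.m+[n∸m]≡n n≤2t) ⟨
        nℚ m * y ^ℚ (n ℕ.+ r)   ≡⟨ cong (nℚ m *_) (^ℚ-+ y n r) ⟩
        nℚ m * (Y * y ^ℚ r)     ≡⟨ solve 3 (λ M Y R → M :* (Y :* R) := (M :* R) :* Y) refl (nℚ m) Y (y ^ℚ r) ⟩
        (nℚ m * y ^ℚ r) * Y     ∎
        where open ≡-Reasoning

  -- Admissible points lie on both sides of c, as 7/5 < c < √2.
  bounded⇒BoundedBy2^tc^[n-2t] : ∀ {m n t} → (∀ x → Admissible x → Bounded x m n t) → BoundedBy2^tc^[n-2t] m n t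
  bounded⇒BoundedBy2^tc^[n-2t] {m} {n} {t} bnd = above , below
    where
    0<7/5 : 0ℚ < 7/5
    0<7/5 = positive⁻¹ 7/5
    at7/5 : Bounded 7/5 m n t
    at7/5 = bnd 7/5 admissible-7/5
    above : 2 ℕ.* t ℕ.≤ n → ∀ x → AboveC x → nℚ m ≤ nℚ (2 ℕ.^ t) * x ^ℚ (n ℕ.∸ 2 ℕ.* t)
    above 2t≤n x (0<x , 0<pc[x]) with x ≤? 7/5
    ... | yes x≤7/5 = contradiction (pc<0 0<x x≤7/5) (<-asym 0<pc[x])
    ... | no x≰7/5 with x * x ≤? nℚ 2
    ...   | yes x²≤2 = bounded⇒m≤2^t·y^[n-2t] 0<x (bnd x (<⇒≤ (≰⇒> x≰7/5) , x²≤2)) 2t≤n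
    ...   | no _ = ≤-trans (bounded⇒m≤2^t·y^[n-2t] 0<7/5 at7/5 2t≤n)
                           (*-monoˡ-≤-0≤ (0≤nℚ (2 ℕ.^ t))
                                         (^ℚ-monoˡ-≤ (<⇒≤ 0<7/5) (<⇒≤ (≰⇒> x≰7/5)) (n ℕ.∸ 2 ℕ.* t)))
    below : n ℕ.≤ 2 ℕ.* t → ∀ x → BelowC x → nℚ m * x ^ℚ (2 ℕ.* t ℕ.∸ n) ≤ nℚ (2 ℕ.^ t)
    below n≤2t x (0<x , pc[x]<0) with x ≤? 7/5
    ... | yes x≤7/5 = ≤-trans (*-monoˡ-≤-0≤ (0≤nℚ m) (^ℚ-monoˡ-≤ (<⇒≤ 0<x) x≤7/5 (2 ℕ.* t ℕ.∸ n)))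
                              (bounded⇒m·y^[2t-n]≤2^t 0<7/5 at7/5 n≤2t)
    ... | no x≰7/5 with x * x ≤? nℚ 2
    ...   | yes x²≤2 = bounded⇒m·y^[2t-n]≤2^t 0<x (bnd x (<⇒≤ (≰⇒> x≰7/5) , x²≤2)) n≤2t
    ...   | no x²≰2 = contradiction (0<pc (<⇒≤ (≰⇒> x≰7/5)) (<⇒≤ (≰⇒> x²≰2))) (<-asym pc[x]<0)

open Bounds

open import Data.Bool using (_∧_)
open import Data.Bool.Properties using (∧-zeroʳ)
open import Data.Fin using (Fin; zero; suc; _≟_)
open import Data.Fin.Properties using (any?; all?)
open import Data.Fin.Subset
  using (Subset; inside; outside; _∈_; _∉_; _⊆_; _∩_; _∪_; _─_; _-_; ⁅_⁆; ∣_∣; ⊤; Nonempty; Empty)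
open import Data.Fin.Subset.Properties
  using ( _∈?_; _⊆?_; nonempty?; drop-there; ⊆-refl; ⊆⊤; ⊥⊆; p─⊥≡p; p─q⊆p; x∈p∩q⁺; x∈p∩q⁻; x∈p∪q⁻
        ; x∈p∧x∉q⇒x∈p─q; x∈p∧x≢y⇒x∈p-y; x∈⁅y⁆⇒x≡y; x∉⁅y⁆⇒x≢y; Empty-unique; ∣⊥∣≡0; ∣⊤∣≡n
        ; x∈p⇒∣p-x∣<∣p∣ )
open import Data.List using (List; []; _∷_; _++_; length; filter; map)
open import Data.List.Properties using (filter-++; length-++; length-filter; filter-accept; filter-none)
open import Data.List.Relation.Unary.All using (universal)
open import Data.Nat using (ℕ; zero; suc; _+_; _≤_; _<_; z≤n; s≤s)
import Data.Nat as ℕ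
open import Data.Nat.Induction using (<-wellFounded)
open import Data.Nat.Properties
  using ( module ≤-Reasoning; ≤-refl; ≤-reflexive; ≤-trans; <-trans; ≤-pred; n≤1+n; m≤n+m; >⇒≢
        ; suc-injective; +-suc; +-identityʳ; +-mono-≤; +-monoˡ-≤; +-monoʳ-≤ )
open import Data.Rational using (ℚ)
open import Data.Vec using (_∷_; []; here; there; tabulate)
import Data.Vec.Functional as Vector
open import Data.Vec.Properties using (lookup∘tabulate; []=⇒lookup; lookup⇒[]=)
open import Function using (_∘_)
open import Function.Definitions using (Injective)
open import Induction.WellFounded using (module All)
open import Level using (0ℓ)
open import Relation.Binary.Construct.On as On using ()
open import Relation.Nullary.Decidable using (map′; decidable-stable)
open import Relation.Unary using (Pred; Decidable)

private variable
  A B : Set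
  P Q R : Pred A 0ℓ
  n : ℕ
  p q : Subset n
  x y z : Fin n

length-filter-map : (P? : Decidable P) (f : B → A) (xs : List B) →
  length (filter P? (map f xs)) ≡ length (filter (P? ∘ f) xs)
length-filter-map P? f [] = refl
length-filter-map P? f (b ∷ bs) with P? (f b)
... | yes _ = cong suc (length-filter-map P? f bs)
... | no _  = length-filter-map P? f bs

length-filter-none : (P? : Decidable P) → (∀ {a} → ¬ P a) → ∀ xs → length (filter P? xs) ≡ 0
length-filter-none P? ¬P xs = cong length (filter-none P? (universal (λ _ → ¬P) xs))

length-filter-∷ : (P? : Decidable P) → ∀ a as → length (filter P? as) ≤ length (filter P? (a ∷ as))
length-filter-∷ P? a as with P? a
... | yes _ = n≤1+n _
... | no _  = ≤-refl

length-filter-accept : (P? : Decidable P) → ∀ {a} as → P a →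
  length (filter P? (a ∷ as)) ≡ suc (length (filter P? as))
length-filter-accept P? as Pa = cong length (filter-accept P? Pa)

length-filter-mono : (P? : Decidable P) (Q? : Decidable Q) → (∀ {a} → P a → Q a) → ∀ xs →
  length (filter P? xs) ≤ length (filter Q? xs)
length-filter-mono P? Q? P⇒Q [] = z≤n
length-filter-mono P? Q? P⇒Q (a ∷ as) with P? a
... | no _  = ≤-trans (length-filter-mono P? Q? P⇒Q as) (length-filter-∷ Q? a as)
... | yes Pa = begin
  suc (length (filter P? as)) ≤⟨ s≤s (length-filter-mono P? Q? P⇒Q as) ⟩
  suc (length (filter Q? as)) ≡⟨ length-filter-accept Q? as (P⇒Q Pa) ⟨
  length (filter Q? (a ∷ as)) ∎
  where open ≤-Reasoning

length-filter-∷-⊎ : (Q? : Decidable Q) (R? : Decidable R) → ∀ {a} as → Q a ⊎ R a →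
  suc (length (filter Q? as) + length (filter R? as)) ≤
  length (filter Q? (a ∷ as)) + length (filter R? (a ∷ as))
length-filter-∷-⊎ Q? R? {a} as (inj₁ Qa) rewrite length-filter-accept Q? as Qa =
  s≤s (+-monoʳ-≤ _ (length-filter-∷ R? a as))
length-filter-∷-⊎ Q? R? {a} as (inj₂ Ra)
  rewrite length-filter-accept R? as Ra | +-suc (length (filter Q? (a ∷ as))) (length (filter R? as)) =
  s≤s (+-monoˡ-≤ _ (length-filter-∷ Q? a as))

length-filter-⊎ : (P? : Decidable P) (Q? : Decidable Q) (R? : Decidable R) →
  (∀ {a} → P a → Q a ⊎ R a) → ∀ xs →
  length (filter P? xs) ≤ length (filter Q? xs) + length (filter R? xs)
length-filter-⊎ P? Q? R? P⇒Q⊎R [] = z≤n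
length-filter-⊎ P? Q? R? P⇒Q⊎R (a ∷ as) with P? a
... | no _ = ≤-trans (length-filter-⊎ P? Q? R? P⇒Q⊎R as)
                     (+-mono-≤ (length-filter-∷ Q? a as) (length-filter-∷ R? a as))
... | yes Pa = ≤-trans (s≤s (length-filter-⊎ P? Q? R? P⇒Q⊎R as))
                       (length-filter-∷-⊎ Q? R? as (P⇒Q⊎R Pa))

countSubsets : {P : Pred (Subset n) 0ℓ} → Decidable P → ℕ
countSubsets {n = n} P? = length (filter P? (allSubsets n))

countSubsets-suc : (P? : Decidable P) →
  countSubsets {n = suc n} P? ≡ countSubsets (P? ∘ (inside ∷_)) + countSubsets (P? ∘ (outside ∷_))
countSubsets-suc {n = n} P? = begin
  length (filter P? (map (inside ∷_) Ss ++ map (outside ∷_) Ss))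
    ≡⟨ cong length (filter-++ P? (map (inside ∷_) Ss) (map (outside ∷_) Ss)) ⟩
  length (filter P? (map (inside ∷_) Ss) ++ filter P? (map (outside ∷_) Ss))
    ≡⟨ length-++ (filter P? (map (inside ∷_) Ss)) ⟩
  length (filter P? (map (inside ∷_) Ss)) + length (filter P? (map (outside ∷_) Ss))
    ≡⟨ cong₂ _+_ (length-filter-map P? (inside ∷_) Ss) (length-filter-map P? (outside ∷_) Ss) ⟩
  countSubsets (P? ∘ (inside ∷_)) + countSubsets (P? ∘ (outside ∷_)) ∎
  where
  open ≡-Reasoning
  Ss : List (Subset n)
  Ss = allSubsets n

countSubsets-mono : (P? : Decidable P) (Q? : Decidable Q) → (∀ {S} → P S → Q S) →
  countSubsets {n = n} P? ≤ countSubsets Q?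
countSubsets-mono {n = n} P? Q? P⇒Q = length-filter-mono P? Q? P⇒Q (allSubsets n)

countSubsets-⊎ : (P? : Decidable P) (Q? : Decidable Q) (R? : Decidable R) →
  (∀ {S} → P S → Q S ⊎ R S) → countSubsets {n = n} P? ≤ countSubsets Q? + countSubsets R?
countSubsets-⊎ {n = n} P? Q? R? P⇒Q⊎R = length-filter-⊎ P? Q? R? P⇒Q⊎R (allSubsets n)

countSubsets-none : (P? : Decidable P) → (∀ {S} → ¬ P S) → countSubsets {n = n} P? ≡ 0
countSubsets-none {n = n} P? ¬P = length-filter-none P? ¬P (allSubsets n)

countSubsets-≤1 : (P? : Decidable P) → (∀ {S} → P S → Empty S) → countSubsets {n = n} P? ≤ 1
countSubsets-≤1 {n = zero} P? _ = length-filter P? (allSubsets 0)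
countSubsets-≤1 {n = suc n} P? P⇒Empty rewrite countSubsets-suc P?
  | countSubsets-none (P? ∘ (inside ∷_)) (λ PS → P⇒Empty PS (zero , here)) =
  countSubsets-≤1 (P? ∘ (outside ∷_)) (λ PS (i , i∈S) → P⇒Empty PS (suc i , there i∈S))

-- S ↦ S - v is injective on the subsets containing v.
countSubsets-remove : (P? : Decidable P) (Q? : Decidable Q) (v : Fin n) →
  (∀ {S} → P S → v ∈ S × Q (S - v)) → countSubsets P? ≤ countSubsets Q?
countSubsets-remove {P = P} {Q = Q} P? Q? zero P⇒ = begin
  countSubsets P?
    ≡⟨ countSubsets-suc P? ⟩
  countSubsets (P? ∘ (inside ∷_)) + countSubsets (P? ∘ (outside ∷_))
    ≡⟨ cong (countSubsets (P? ∘ (inside ∷_)) +_)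
            (countSubsets-none (P? ∘ (outside ∷_)) (λ PS → contradiction (proj₁ (P⇒ PS)) λ ())) ⟩
  countSubsets (P? ∘ (inside ∷_)) + 0
    ≡⟨ +-identityʳ _ ⟩
  countSubsets (P? ∘ (inside ∷_))
    ≤⟨ countSubsets-mono (P? ∘ (inside ∷_)) (Q? ∘ (outside ∷_)) Q-outside ⟩
  countSubsets (Q? ∘ (outside ∷_))
    ≤⟨ m≤n+m _ _ ⟩
  countSubsets (Q? ∘ (inside ∷_)) + countSubsets (Q? ∘ (outside ∷_))
    ≡⟨ countSubsets-suc Q? ⟨
  countSubsets Q? ∎
  where
  open ≤-Reasoning
  Q-outside : ∀ {S} → P (inside ∷ S) → Q (outside ∷ S)
  Q-outside {S} PS = subst (λ S′ → Q (outside ∷ S′)) (p─⊥≡p S) (proj₂ (P⇒ PS))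
countSubsets-remove P? Q? (suc v) P⇒ rewrite countSubsets-suc P? | countSubsets-suc Q? =
  +-mono-≤ (countSubsets-remove (P? ∘ (inside ∷_)) (Q? ∘ (inside ∷_)) v (map₁ drop-there ∘ P⇒))
           (countSubsets-remove (P? ∘ (outside ∷_)) (Q? ∘ (outside ∷_)) v (map₁ drop-there ∘ P⇒))

∣p∣≡1+∣p-x∣ : x ∈ p → ∣ p ∣ ≡ suc ∣ p - x ∣
∣p∣≡1+∣p-x∣ {p = inside ∷ p} here = cong (suc ∘ ∣_∣) (sym (p─⊥≡p p))
∣p∣≡1+∣p-x∣ {p = inside ∷ p} (there x∈p) = cong suc (∣p∣≡1+∣p-x∣ x∈p)
∣p∣≡1+∣p-x∣ {p = outside ∷ p} (there x∈p) = ∣p∣≡1+∣p-x∣ x∈p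

∣p∣≡∣p∩q∣+∣p─q∣ : ∀ (p q : Subset n) → ∣ p ∣ ≡ ∣ p ∩ q ∣ + ∣ p ─ q ∣
∣p∣≡∣p∩q∣+∣p─q∣ [] [] = refl
∣p∣≡∣p∩q∣+∣p─q∣ (inside ∷ p) (inside ∷ q) = cong suc (∣p∣≡∣p∩q∣+∣p─q∣ p q)
∣p∣≡∣p∩q∣+∣p─q∣ (inside ∷ p) (outside ∷ q) =
  trans (cong suc (∣p∣≡∣p∩q∣+∣p─q∣ p q)) (sym (+-suc ∣ p ∩ q ∣ ∣ p ─ q ∣))
∣p∣≡∣p∩q∣+∣p─q∣ (outside ∷ p) (inside ∷ q) = ∣p∣≡∣p∩q∣+∣p─q∣ p q
∣p∣≡∣p∩q∣+∣p─q∣ (outside ∷ p) (outside ∷ q) = ∣p∣≡∣p∩q∣+∣p─q∣ p q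

x∈p⇒0<∣p∣ : x ∈ p → 0 < ∣ p ∣
x∈p⇒0<∣p∣ x∈p = subst (0 <_) (sym (∣p∣≡1+∣p-x∣ x∈p)) (s≤s z≤n)

Empty⇒∣p∣≡0 : ∀ {n} {p : Subset n} → Empty p → ∣ p ∣ ≡ 0
Empty⇒∣p∣≡0 {n = n} {p = p} empty = trans (cong ∣_∣ (Empty-unique {p = p} empty)) (∣⊥∣≡0 n)

0<∣p∣⇒Nonempty : 0 < ∣ p ∣ → Nonempty p
0<∣p∣⇒Nonempty {p = p} 0<∣p∣ with nonempty? p
... | yes nonempty = nonempty
... | no empty     = contradiction (Empty⇒∣p∣≡0 empty) (>⇒≢ 0<∣p∣)

x∈p─q⇒x∉q : x ∈ p ─ q → x ∉ q
x∈p─q⇒x∉q {p = _ ∷ _} {q = inside ∷ _} () here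
x∈p─q⇒x∉q {p = _ ∷ _} {q = _ ∷ _} (there x∈p─q) (there x∈q) = x∈p─q⇒x∉q x∈p─q x∈q

x∈p-y⇒x≢y : x ∈ p - y → x ≢ y
x∈p-y⇒x≢y = x∉⁅y⁆⇒x≢y ∘ x∈p─q⇒x∉q

∣p-x∣≡pred∣p∣ : ∀ {m} → x ∈ p → ∣ p ∣ ≡ suc m → ∣ p - x ∣ ≡ m
∣p-x∣≡pred∣p∣ x∈p ∣p∣≡1+m = suc-injective (trans (sym (∣p∣≡1+∣p-x∣ x∈p)) ∣p∣≡1+m)

∣p∣≡1⇒≡ : ∣ p ∣ ≡ 1 → x ∈ p → y ∈ p → y ≡ x
∣p∣≡1⇒≡ {x = x} {y = y} ∣p∣≡1 x∈p y∈p with y ≟ x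
... | yes y≡x = y≡x
... | no y≢x  =
  contradiction (∣p-x∣≡pred∣p∣ x∈p ∣p∣≡1) (>⇒≢ (x∈p⇒0<∣p∣ (x∈p∧x≢y⇒x∈p-y y∈p y≢x)))

∣p∣≡2⇒∃≢ : ∣ p ∣ ≡ 2 → x ∈ p → ∃[ y ] y ∈ p × y ≢ x
∣p∣≡2⇒∃≢ {p = p} {x = x} ∣p∣≡2 x∈p
  with 0<∣p∣⇒Nonempty {p = p - x} (subst (0 <_) (sym (∣p-x∣≡pred∣p∣ x∈p ∣p∣≡2)) (s≤s z≤n))
... | y , y∈p-x = y , p─q⊆p p _ y∈p-x , x∈p-y⇒x≢y y∈p-x

∣p∣≡2⇒≡ : ∣ p ∣ ≡ 2 → x ∈ p → y ∈ p → y ≢ x → z ∈ p → z ≢ x → z ≡ y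
∣p∣≡2⇒≡ ∣p∣≡2 x∈p y∈p y≢x z∈p z≢x =
  ∣p∣≡1⇒≡ (∣p-x∣≡pred∣p∣ x∈p ∣p∣≡2) (x∈p∧x≢y⇒x∈p-y y∈p y≢x) (x∈p∧x≢y⇒x∈p-y z∈p z≢x)

x∉q⇒[p-x]∩q≡p∩q : x ∉ q → (p - x) ∩ q ≡ p ∩ q
x∉q⇒[p-x]∩q≡p∩q {x = zero} {q = inside ∷ _} {p = _ ∷ _} 0∉q = contradiction here 0∉q
x∉q⇒[p-x]∩q≡p∩q {x = zero} {q = outside ∷ q} {p = b ∷ p} _ =
  cong₂ _∷_ (sym (∧-zeroʳ b)) (cong (_∩ q) (p─⊥≡p p))
x∉q⇒[p-x]∩q≡p∩q {x = suc x} {q = c ∷ _} {p = b ∷ _} x∉q =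
  cong (b ∧ c ∷_) (x∉q⇒[p-x]∩q≡p∩q (x∉q ∘ there))

lift : ∀ {s} → Fin s ⊎ Fin s → Fin (suc s) ⊎ Fin (suc s)
lift = Sum.map suc suc

data EndpointView {s : ℕ} : Fin (suc s) ⊎ Fin (suc s) → Set where
  newˡ : EndpointView (inj₁ zero)
  newʳ : EndpointView (inj₂ zero)
  old  : ∀ z → EndpointView (lift z)

endpointView : ∀ {s} z → EndpointView {s} z
endpointView (inj₁ zero)    = newˡ
endpointView (inj₂ zero)    = newʳ
endpointView (inj₁ (suc a)) = old (inj₁ a)
endpointView (inj₂ (suc a)) = old (inj₂ a)

endpoint-lift : ∀ {s} (l r : Fin (suc s) → Fin n) z → endpoint l r (lift z) ≡ endpoint (l ∘ suc) (r ∘ suc) z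
endpoint-lift l r (inj₁ a) = refl
endpoint-lift l r (inj₂ a) = refl

edgeIndex-lift : ∀ {s} (z : Fin s ⊎ Fin s) → edgeIndex (lift z) ≡ suc (edgeIndex z)
edgeIndex-lift (inj₁ a) = refl
edgeIndex-lift (inj₂ a) = refl

module InducedSubgraph {n : ℕ} (G : Graph n) where

  private variable
    W W′ S : Subset n
    u v w : Fin n

  adjacent-sym : Adjacent G u v → Adjacent G v u
  adjacent-sym {u} {v} uv = trans (Graph.sym G v u) uv

  adjacent⇒≢ : Adjacent G u v → u ≢ v
  adjacent⇒≢ {u} uv refl = contradiction (trans (sym uv) (irrefl G u)) λ ()

  nbhd : Fin n → Subset n
  nbhd v = tabulate (adj G v)

  ∈nbhd⁺ : Adjacent G v u → u ∈ nbhd v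
  ∈nbhd⁺ {v} {u} vu = lookup⇒[]= u (nbhd v) (trans (lookup∘tabulate (adj G v) u) vu)

  ∈nbhd⁻ : u ∈ nbhd v → Adjacent G v u
  ∈nbhd⁻ {u} {v} u∈N = trans (sym (lookup∘tabulate (adj G v) u)) ([]=⇒lookup u∈N)

  v∉nbhd[v] : v ∉ nbhd v
  v∉nbhd[v] v∈N = adjacent⇒≢ (∈nbhd⁻ v∈N) refl

  infixl 5 _∖N[_]
  _∖N[_] : Subset n → Fin n → Subset n
  W ∖N[ v ] = W - v ─ nbhd v

  ∖N[]⊆ : W ∖N[ v ] ⊆ W
  ∖N[]⊆ {W} {v} = p─q⊆p W _ ∘ p─q⊆p (W - v) (nbhd v)

  ∈∖N[]⇒≢ : u ∈ W ∖N[ v ] → u ≢ v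
  ∈∖N[]⇒≢ {W = W} {v} = x∈p-y⇒x≢y ∘ p─q⊆p (W - v) (nbhd v)

  ∈∖N[]⇒≁ : u ∈ W ∖N[ v ] → ¬ Adjacent G v u
  ∈∖N[]⇒≁ u∈ vu = x∈p─q⇒x∉q u∈ (∈nbhd⁺ vu)

  ∈∖N[]⁺ : u ∈ W → u ≢ v → ¬ Adjacent G v u → u ∈ W ∖N[ v ]
  ∈∖N[]⁺ u∈W u≢v v≁u = x∈p∧x∉q⇒x∈p─q (x∈p∧x≢y⇒x∈p-y u∈W u≢v) (v≁u ∘ ∈nbhd⁻)

  ∖N[]-mono : W′ ⊆ W → W′ ∖N[ v ] ⊆ W ∖N[ v ]
  ∖N[]-mono W′⊆W u∈ = ∈∖N[]⁺ (W′⊆W (∖N[]⊆ u∈)) (∈∖N[]⇒≢ u∈) (∈∖N[]⇒≁ u∈)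

  ∖N[]-pendant : Adjacent G v u → (∀ {w} → w ∈ W → Adjacent G v w → w ≡ u) →
                 W ∖N[ u ] ⊆ W ∖N[ v ]
  ∖N[]-pendant vu unique w∈ =
    ∈∖N[]⁺ (∖N[]⊆ w∈) (λ { refl → ∈∖N[]⇒≁ w∈ (adjacent-sym vu) })
           (λ vw → ∈∖N[]⇒≢ w∈ (unique (∖N[]⊆ w∈) vw))

  degreeIn : Subset n → Fin n → ℕ
  degreeIn W v = ∣ W ∩ nbhd v ∣

  ∈∩nbhd⁺ : u ∈ W → Adjacent G v u → u ∈ W ∩ nbhd v
  ∈∩nbhd⁺ u∈W vu = x∈p∩q⁺ (u∈W , ∈nbhd⁺ vu)

  ∈∩nbhd⁻ : u ∈ W ∩ nbhd v → u ∈ W × Adjacent G v u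
  ∈∩nbhd⁻ {W = W} {v} u∈ = map₂ ∈nbhd⁻ (x∈p∩q⁻ W (nbhd v) u∈)

  ∣W∣≡1+d+∣W∖N[v]∣ : ∀ {d} → v ∈ W → degreeIn W v ≡ d → ∣ W ∣ ≡ suc (d + ∣ W ∖N[ v ] ∣)
  ∣W∣≡1+d+∣W∖N[v]∣ {v} {W} {d} v∈W deg≡d = begin
    ∣ W ∣                                        ≡⟨ ∣p∣≡1+∣p-x∣ v∈W ⟩
    suc ∣ W - v ∣                                ≡⟨ cong suc (∣p∣≡∣p∩q∣+∣p─q∣ (W - v) (nbhd v)) ⟩
    suc (∣ (W - v) ∩ nbhd v ∣ + ∣ W ∖N[ v ] ∣)
      ≡⟨ cong (λ X → suc (∣ X ∣ + ∣ W ∖N[ v ] ∣)) (x∉q⇒[p-x]∩q≡p∩q {p = W} v∉nbhd[v]) ⟩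
    suc (degreeIn W v + ∣ W ∖N[ v ] ∣)          ≡⟨ cong (λ d → suc (d + ∣ W ∖N[ v ] ∣)) deg≡d ⟩
    suc (d + ∣ W ∖N[ v ] ∣)                     ∎
    where open ≡-Reasoning

  ∣W∖N[v]∣<∣W∣ : v ∈ W → ∣ W ∖N[ v ] ∣ < ∣ W ∣
  ∣W∖N[v]∣<∣W∣ {v} {W} v∈W = subst (∣ W ∖N[ v ] ∣ <_) (sym (∣W∣≡1+d+∣W∖N[v]∣ v∈W refl)) (s≤s (m≤n+m _ _))

  degreeIn-delete : v ∉ nbhd u → degreeIn (W - v) u ≡ degreeIn W u
  degreeIn-delete {W = W} v∉N[u] = cong ∣_∣ (x∉q⇒[p-x]∩q≡p∩q {p = W} v∉N[u])

  neighbourIn : 0 < degreeIn W v → ∃[ u ] u ∈ W × Adjacent G v u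
  neighbourIn {W} {v} 0<deg = map₂ ∈∩nbhd⁻ (0<∣p∣⇒Nonempty {p = W ∩ nbhd v} 0<deg)

  0<degreeIn : u ∈ W → Adjacent G v u → 0 < degreeIn W v
  0<degreeIn u∈W vu = x∈p⇒0<∣p∣ (∈∩nbhd⁺ u∈W vu)

  degreeIn≡1⇒unique : degreeIn W v ≡ 1 → u ∈ W → Adjacent G v u →
                      ∀ {w} → w ∈ W → Adjacent G v w → w ≡ u
  degreeIn≡1⇒unique deg≡1 u∈W vu w∈W vw = ∣p∣≡1⇒≡ deg≡1 (∈∩nbhd⁺ u∈W vu) (∈∩nbhd⁺ w∈W vw)

  degreeIn≡2⇒other : degreeIn W v ≡ 2 → u ∈ W → Adjacent G v u →
                     ∃[ w ] w ∈ W × Adjacent G v w × w ≢ u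
  degreeIn≡2⇒other deg≡2 u∈W vu with ∣p∣≡2⇒∃≢ deg≡2 (∈∩nbhd⁺ u∈W vu)
  ... | w , w∈ , w≢u = w , proj₁ (∈∩nbhd⁻ w∈) , proj₂ (∈∩nbhd⁻ w∈) , w≢u

  degreeIn≡2⇒unique : degreeIn W v ≡ 2 → u ∈ W → Adjacent G v u → w ∈ W → Adjacent G v w → w ≢ u →
                      ∀ {z} → z ∈ W - u → Adjacent G v z → z ≡ w
  degreeIn≡2⇒unique {W = W} {u = u} deg≡2 u∈W vu w∈W vw w≢u z∈W-u vz =
    ∣p∣≡2⇒≡ deg≡2 (∈∩nbhd⁺ u∈W vu) (∈∩nbhd⁺ w∈W vw) w≢u
            (∈∩nbhd⁺ (p─q⊆p W _ z∈W-u) vz) (x∈p-y⇒x≢y z∈W-u)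

  Dominating : Subset n → Subset n → Set
  Dominating W S = ∀ v → v ∈ W → v ∉ S → ∃[ u ] u ∈ S × Adjacent G u v

  record MaximalIndependentIn (W S : Subset n) : Set where
    constructor mkMaximalIndependentIn
    field
      ⊆W          : S ⊆ W
      independent : Independent G S
      dominating  : Dominating W S

  open MaximalIndependentIn

  maximalIndependentIn? : ∀ W S → Dec (MaximalIndependentIn W S)
  maximalIndependentIn? W S = map′ pack (λ m → ⊆W m , independent m , dominating m) decided
    where
    pack : S ⊆ W × Independent G S × Dominating W S → MaximalIndependentIn W S
    pack (s , i , d) = mkMaximalIndependentIn s i d
    decided : Dec (S ⊆ W × Independent G S × Dominating W S)
    decided = S ⊆? W ×-dec independent? G S ×-dec
              all? λ v → v ∈? W →-dec ¬? (v ∈? S) →-dec any? λ u → u ∈? S ×-dec adjacent? G u v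

  misIn : Subset n → ℕ
  misIn W = countSubsets (maximalIndependentIn? W)

  containing? : ∀ W v → Decidable (λ S → MaximalIndependentIn W S × v ∈ S)
  containing? W v S = maximalIndependentIn? W S ×-dec v ∈? S

  misContaining : Subset n → Fin n → ℕ
  misContaining W v = countSubsets (containing? W v)

  maximalIndependent⇒In⊤ : MaximalIndependent G S → MaximalIndependentIn ⊤ S
  maximalIndependent⇒In⊤ {S} (ind , maximal) = record
    { ⊆W = ⊆⊤ ; independent = ind ; dominating = dom }
    where
    dom : Dominating ⊤ S
    dom v _ v∉S with any? (λ u → u ∈? S ×-dec adjacent? G u v)
    ... | yes found = found
    ... | no none = contradiction ind′ (maximal v v∉S)
      where
      ind′ : Independent G (S ∪ ⁅ v ⁆)
      ind′ i j i∈ j∈ with x∈p∪q⁻ S ⁅ v ⁆ i∈ | x∈p∪q⁻ S ⁅ v ⁆ j∈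
      ... | inj₁ i∈S | inj₁ j∈S = ind i j i∈S j∈S
      ... | inj₁ i∈S | inj₂ j∈v rewrite x∈⁅y⁆⇒x≡y v j∈v = λ iv → none (i , i∈S , iv)
      ... | inj₂ i∈v | inj₁ j∈S rewrite x∈⁅y⁆⇒x≡y v i∈v = λ vj → none (j , j∈S , adjacent-sym vj)
      ... | inj₂ i∈v | inj₂ j∈v rewrite x∈⁅y⁆⇒x≡y v i∈v | x∈⁅y⁆⇒x≡y v j∈v = λ vv → adjacent⇒≢ vv refl

  mis≤misIn⊤ : mis G ≤ misIn ⊤
  mis≤misIn⊤ = countSubsets-mono (maximalIndependent? G) (maximalIndependentIn? ⊤) maximalIndependent⇒In⊤

  maximalIndependentIn-∖N[] : MaximalIndependentIn W S → v ∈ S →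
                              MaximalIndependentIn (W ∖N[ v ]) (S - v)
  maximalIndependentIn-∖N[] {W} {S} {v} m v∈S = record
    { ⊆W = λ u∈ → ∈∖N[]⁺ (⊆W m (∈S u∈)) (x∈p-y⇒x≢y u∈) (independent m v _ v∈S (∈S u∈))
    ; independent = λ i j i∈ j∈ → independent m i j (∈S i∈) (∈S j∈)
    ; dominating = dom
    }
    where
    ∈S : S - v ⊆ S
    ∈S = p─q⊆p S ⁅ v ⁆
    dom : Dominating (W ∖N[ v ]) (S - v)
    dom u u∈ u∉ with dominating m u (∖N[]⊆ u∈) (λ u∈S → u∉ (x∈p∧x≢y⇒x∈p-y u∈S (∈∖N[]⇒≢ u∈)))
    ... | w , w∈S , wu = w , x∈p∧x≢y⇒x∈p-y w∈S (λ { refl → ∈∖N[]⇒≁ u∈ wu }) , wu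

  maximalIndependentIn-delete : MaximalIndependentIn W S → v ∉ S → MaximalIndependentIn (W - v) S
  maximalIndependentIn-delete {W} m v∉S = record
    { ⊆W = λ u∈S → x∈p∧x≢y⇒x∈p-y (⊆W m u∈S) (λ { refl → v∉S u∈S })
    ; independent = independent m
    ; dominating = λ u u∈ → dominating m u (p─q⊆p W _ u∈)
    }

  ∈-or-neighbour∈ : MaximalIndependentIn W S → v ∈ W → v ∈ S ⊎ ∃[ u ] u ∈ S × u ∈ W × Adjacent G v u
  ∈-or-neighbour∈ {S = S} {v} m v∈W with v ∈? S
  ... | yes v∈S = inj₁ v∈S
  ... | no v∉S with dominating m v v∈W v∉S
  ...   | u , u∈S , uv = inj₂ (u , u∈S , ⊆W m u∈S , adjacent-sym uv)

  misContaining≤misIn∖N[] : misContaining W v ≤ misIn (W ∖N[ v ])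
  misContaining≤misIn∖N[] {W} {v} = countSubsets-remove (containing? W v) (maximalIndependentIn? (W ∖N[ v ]))
    v (λ (m , v∈S) → v∈S , maximalIndependentIn-∖N[] m v∈S)

  misIn-branch : misIn W ≤ misIn (W ∖N[ v ]) + misIn (W - v)
  misIn-branch {W} {v} = ≤-trans
    (countSubsets-⊎ (maximalIndependentIn? W) (containing? W v) (maximalIndependentIn? (W - v)) split)
    (+-monoˡ-≤ (misIn (W - v)) misContaining≤misIn∖N[])
    where
    split : ∀ {S} → MaximalIndependentIn W S →
            (MaximalIndependentIn W S × v ∈ S) ⊎ MaximalIndependentIn (W - v) S
    split {S} m with v ∈? S
    ... | yes v∈S = inj₁ (m , v∈S)
    ... | no v∉S  = inj₂ (maximalIndependentIn-delete m v∉S)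

  misIn-isolated : v ∈ W → (∀ {u} → u ∈ W → ¬ Adjacent G v u) → misIn W ≤ misIn (W ∖N[ v ])
  misIn-isolated {v} {W} v∈W no-neighbour =
    ≤-trans (countSubsets-mono (maximalIndependentIn? W) (containing? W v) (λ m → m , v∈ m))
            misContaining≤misIn∖N[]
    where
    v∈ : ∀ {S} → MaximalIndependentIn W S → v ∈ S
    v∈ m with ∈-or-neighbour∈ m v∈W
    ... | inj₁ v∈S = v∈S
    ... | inj₂ (_ , _ , u∈W , vu) = contradiction vu (no-neighbour u∈W)

  misIn-pendant : v ∈ W → (∀ {w} → w ∈ W → Adjacent G v w → w ≡ u) →
                  misIn W ≤ misIn (W ∖N[ v ]) + misIn (W ∖N[ u ])
  misIn-pendant {v} {W} {u} v∈W unique = ≤-trans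
    (countSubsets-⊎ (maximalIndependentIn? W) (containing? W v) (containing? W u) split)
    (+-mono-≤ misContaining≤misIn∖N[] misContaining≤misIn∖N[])
    where
    split : ∀ {S} → MaximalIndependentIn W S →
            (MaximalIndependentIn W S × v ∈ S) ⊎ (MaximalIndependentIn W S × u ∈ S)
    split {S} m with ∈-or-neighbour∈ m v∈W
    ... | inj₁ v∈S = inj₁ (m , v∈S)
    ... | inj₂ (w , w∈S , w∈W , vw) = inj₂ (m , subst (_∈ S) (unique w∈W vw) w∈S)

  open InducedMatching

  InducedMatchingIn : Subset n → ℕ → Set
  InducedMatchingIn W s = Σ[ M ∈ InducedMatching G s ] (∀ z → endpoint (left M) (right M) z ∈ W)

  inducedMatchingIn-mono : ∀ {s} → W′ ⊆ W → InducedMatchingIn W′ s → InducedMatchingIn W s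
  inducedMatchingIn-mono W′⊆W (M , ends∈W′) = M , W′⊆W ∘ ends∈W′

  emptyInducedMatchingIn : InducedMatchingIn W 0
  emptyInducedMatchingIn = M , λ { (inj₁ ()) ; (inj₂ ()) }
    where
    M : InducedMatching G 0
    M = record
      { left = λ () ; right = λ () ; isEdge = λ ()
      ; distinct = λ { {inj₁ ()} ; {inj₂ ()} }
      ; induced = λ { (inj₁ ()) ; (inj₂ ()) }
      }

  module _ {W W′ : Subset n} {u v : Fin n} {s : ℕ}
           (uv : Adjacent G u v) (far-u : W′ ⊆ W ∖N[ u ]) (far-v : W′ ⊆ W ∖N[ v ])
           (M : InducedMatching G s) (ends∈W′ : ∀ z → endpoint (left M) (right M) z ∈ W′) where

    private
      ends : Fin s ⊎ Fin s → Fin n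
      ends = endpoint (left M) (right M)
      ends′ : Fin (suc s) ⊎ Fin (suc s) → Fin n
      ends′ = endpoint (u Vector.∷ left M) (v Vector.∷ right M)

      ends′-lift : ∀ z → ends′ (lift z) ≡ ends z
      ends′-lift = endpoint-lift (u Vector.∷ left M) (v Vector.∷ right M)

      old≢u : ∀ z → ends z ≢ u
      old≢u z = ∈∖N[]⇒≢ (far-u (ends∈W′ z))

      old≢v : ∀ z → ends z ≢ v
      old≢v z = ∈∖N[]⇒≢ (far-v (ends∈W′ z))

      u≁old : ∀ z → ¬ Adjacent G u (ends z)
      u≁old z = ∈∖N[]⇒≁ (far-u (ends∈W′ z))

      v≁old : ∀ z → ¬ Adjacent G v (ends z)
      v≁old z = ∈∖N[]⇒≁ (far-v (ends∈W′ z))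

    extended-distinct : Injective _≡_ _≡_ ends′
    extended-distinct {x} {y} eq with endpointView x | endpointView y
    ... | newˡ  | newˡ   = refl
    ... | newʳ  | newʳ   = refl
    ... | newˡ  | newʳ   = contradiction eq (adjacent⇒≢ uv)
    ... | newʳ  | newˡ   = contradiction (sym eq) (adjacent⇒≢ uv)
    ... | newˡ  | old z  = contradiction (trans (sym (ends′-lift z)) (sym eq)) (old≢u z)
    ... | newʳ  | old z  = contradiction (trans (sym (ends′-lift z)) (sym eq)) (old≢v z)
    ... | old z | newˡ   = contradiction (trans (sym (ends′-lift z)) eq) (old≢u z)
    ... | old z | newʳ   = contradiction (trans (sym (ends′-lift z)) eq) (old≢v z)
    ... | old z | old z′ = cong lift (distinct M {z} {z′} (trans (sym (ends′-lift z)) (trans eq (ends′-lift z′))))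

    extended-induced : ∀ x y → Adjacent G (ends′ x) (ends′ y) → edgeIndex x ≡ edgeIndex y
    extended-induced x y xy with endpointView x | endpointView y
    ... | newˡ  | newˡ   = refl
    ... | newˡ  | newʳ   = refl
    ... | newʳ  | newˡ   = refl
    ... | newʳ  | newʳ   = refl
    ... | newˡ  | old z  = contradiction (subst (Adjacent G u) (ends′-lift z) xy) (u≁old z)
    ... | newʳ  | old z  = contradiction (subst (Adjacent G v) (ends′-lift z) xy) (v≁old z)
    ... | old z | newˡ   = contradiction (subst (Adjacent G u) (ends′-lift z) (adjacent-sym xy)) (u≁old z)
    ... | old z | newʳ   = contradiction (subst (Adjacent G v) (ends′-lift z) (adjacent-sym xy)) (v≁old z)
    ... | old z | old z′ = begin
      edgeIndex (lift z)   ≡⟨ edgeIndex-lift z ⟩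
      suc (edgeIndex z)    ≡⟨ cong suc (induced M z z′ (subst₂ (Adjacent G) (ends′-lift z) (ends′-lift z′) xy)) ⟩
      suc (edgeIndex z′)   ≡⟨ edgeIndex-lift z′ ⟨
      edgeIndex (lift z′)  ∎
      where open ≡-Reasoning

    extended : InducedMatching G (suc s)
    extended = record
      { left = u Vector.∷ left M ; right = v Vector.∷ right M
      ; isEdge = λ { zero → uv ; (suc a) → isEdge M a }
      ; distinct = extended-distinct ; induced = extended-induced
      }

    extended-ends∈W : u ∈ W → v ∈ W → ∀ z → ends′ z ∈ W
    extended-ends∈W u∈W v∈W z with endpointView z
    ... | newˡ  = u∈W
    ... | newʳ  = v∈W
    ... | old z = subst (_∈ W) (sym (ends′-lift z)) (∖N[]⊆ (far-u (ends∈W′ z)))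

  inducedMatchingIn-extend : ∀ {s} → Adjacent G u v → u ∈ W → v ∈ W →
    W′ ⊆ W ∖N[ u ] → W′ ⊆ W ∖N[ v ] → InducedMatchingIn W′ s → InducedMatchingIn W (suc s)
  inducedMatchingIn-extend uv u∈W v∈W far-u far-v (M , ends∈W′) =
    extended uv far-u far-v M ends∈W′ , extended-ends∈W uv far-u far-v M ends∈W′ u∈W v∈W

  edge⇒inducedMatchingIn : Adjacent G u v → u ∈ W → v ∈ W → InducedMatchingIn W 1
  edge⇒inducedMatchingIn uv u∈W v∈W = inducedMatchingIn-extend uv u∈W v∈W ⊥⊆ ⊥⊆ emptyInducedMatchingIn

  data DegreeCase (W : Subset n) : Set where
    empty      : Empty W → DegreeCase W
    isolated   : v ∈ W → degreeIn W v ≡ 0 → DegreeCase W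
    pendant    : v ∈ W → degreeIn W v ≡ 1 → DegreeCase W
    highDegree : ∀ {r} → v ∈ W → degreeIn W v ≡ 3 + r → DegreeCase W
    2-regular  : v ∈ W → (∀ {u} → u ∈ W → degreeIn W u ≡ 2) → DegreeCase W

  degreeCase-≢2 : v ∈ W → degreeIn W v ≢ 2 → DegreeCase W
  degreeCase-≢2 {v} {W} v∈W deg≢2 with degreeIn W v in deg
  ... | 0                 = isolated v∈W deg
  ... | 1                 = pendant v∈W deg
  ... | 2                 = contradiction refl deg≢2
  ... | suc (suc (suc r)) = highDegree v∈W deg

  degreeCase : ∀ W → DegreeCase W
  degreeCase W with any? (λ v → v ∈? W ×-dec ¬? (degreeIn W v ℕ.≟ 2))
  ... | yes (_ , v∈W , deg≢2) = degreeCase-≢2 v∈W deg≢2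
  ... | no noneIrregular with nonempty? W
  ...   | no W-empty    = empty W-empty
  ...   | yes (_ , v∈W) = 2-regular v∈W λ {u} u∈W →
    decidable-stable (degreeIn W u ℕ.≟ 2) (λ deg≢2 → noneIrregular (u , u∈W , deg≢2))

module _ {n : ℕ} (G : Graph n) (triangleFree : TriangleFree G) {x : ℚ} (admissible : Admissible x) where

  open InducedSubgraph G
  open MaximalIndependentIn
  open Recurrences admissible

  private variable
    W : Subset n
    u v : Fin n

  MisBounded : Subset n → Set
  MisBounded W = ∀ t → ¬ InducedMatchingIn W (suc t) → Bounded x (misIn W) ∣ W ∣ t

  Smaller : Subset n → Set
  Smaller W = ∀ {W′} → ∣ W′ ∣ < ∣ W ∣ → MisBounded W′

  bounded-resize : ∀ {m k k′ t} → k ≡ k′ → Bounded x m k t → Bounded x m k′ t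
  bounded-resize k≡k′ = bounded-size-≤ (≤-reflexive k≡k′)

  emptyCase : Empty W → MisBounded W
  emptyCase {W} W-empty t _ = bounded-resize (sym (Empty⇒∣p∣≡0 W-empty)) (bounded-≤ misIn≤1 bounded-1)
    where
    misIn≤1 : misIn W ≤ 1
    misIn≤1 = countSubsets-≤1 (maximalIndependentIn? W) (λ m (i , i∈S) → W-empty (i , ⊆W m i∈S))

  isolatedCase : v ∈ W → degreeIn W v ≡ 0 → Smaller W → MisBounded W
  isolatedCase {v} {W} v∈W deg≡0 ih t noIM =
    bounded-resize (sym (∣W∣≡1+d+∣W∖N[v]∣ v∈W deg≡0))
      (bounded-≤ (misIn-isolated v∈W no-neighbour) (bounded-size-≤ (n≤1+n _) recN))
    where
    no-neighbour : ∀ {u} → u ∈ W → ¬ Adjacent G v u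
    no-neighbour u∈W vu = >⇒≢ (0<degreeIn u∈W vu) deg≡0
    recN : Bounded x (misIn (W ∖N[ v ])) ∣ W ∖N[ v ] ∣ t
    recN = ih (∣W∖N[v]∣<∣W∣ v∈W) t (noIM ∘ inducedMatchingIn-mono ∖N[]⊆)

  highDegreeCase : ∀ {r} → v ∈ W → degreeIn W v ≡ 3 + r → Smaller W → MisBounded W
  highDegreeCase {v} {W} {r} v∈W deg≡3+r ih t noIM =
    bounded-resize (sym ∣W∣≡4+k)
      (bounded-≤ misIn-branch
        (bounded-highDegree (bounded-size-≤ (m≤n+m _ r) recN) (bounded-resize ∣W-v∣≡3+k recD)))
    where
    k : ℕ
    k = r + ∣ W ∖N[ v ] ∣
    ∣W∣≡4+k : ∣ W ∣ ≡ 4 + k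
    ∣W∣≡4+k = ∣W∣≡1+d+∣W∖N[v]∣ v∈W deg≡3+r
    ∣W-v∣≡3+k : ∣ W - v ∣ ≡ 3 + k
    ∣W-v∣≡3+k = suc-injective (trans (sym (∣p∣≡1+∣p-x∣ v∈W)) ∣W∣≡4+k)
    recN : Bounded x (misIn (W ∖N[ v ])) ∣ W ∖N[ v ] ∣ t
    recN = ih (∣W∖N[v]∣<∣W∣ v∈W) t (noIM ∘ inducedMatchingIn-mono ∖N[]⊆)
    recD : Bounded x (misIn (W - v)) ∣ W - v ∣ t
    recD = ih (x∈p⇒∣p-x∣<∣p∣ v∈W) t (noIM ∘ inducedMatchingIn-mono (p─q⊆p W _))

  isolatedEdgeCase : v ∈ W → u ∈ W → Adjacent G v u → degreeIn W v ≡ 1 → degreeIn W u ≡ 1 → Smaller W →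
                     ∀ t → ¬ InducedMatchingIn W (2 + t) → Bounded x (misIn W) ∣ W ∣ (suc t)
  isolatedEdgeCase {v} {W} {u} v∈W u∈W vu deg[v]≡1 deg[u]≡1 ih t noIM =
    bounded-resize (sym ∣W∣≡2+∣W∖N[v]∣)
      (bounded-≤ (misIn-pendant v∈W only-u)
        (bounded-isolatedEdge recV (bounded-resize ∣W∖N[u]∣≡∣W∖N[v]∣ recU)))
    where
    only-u : ∀ {w} → w ∈ W → Adjacent G v w → w ≡ u
    only-u = degreeIn≡1⇒unique deg[v]≡1 u∈W vu
    only-v : ∀ {w} → w ∈ W → Adjacent G u w → w ≡ v
    only-v = degreeIn≡1⇒unique deg[u]≡1 v∈W (adjacent-sym vu)
    ∣W∣≡2+∣W∖N[v]∣ : ∣ W ∣ ≡ 2 + ∣ W ∖N[ v ] ∣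
    ∣W∣≡2+∣W∖N[v]∣ = ∣W∣≡1+d+∣W∖N[v]∣ v∈W deg[v]≡1
    ∣W∖N[u]∣≡∣W∖N[v]∣ : ∣ W ∖N[ u ] ∣ ≡ ∣ W ∖N[ v ] ∣
    ∣W∖N[u]∣≡∣W∖N[v]∣ =
      suc-injective (suc-injective (trans (sym (∣W∣≡1+d+∣W∖N[v]∣ u∈W deg[u]≡1)) ∣W∣≡2+∣W∖N[v]∣))
    recV : Bounded x (misIn (W ∖N[ v ])) ∣ W ∖N[ v ] ∣ t
    recV = ih (∣W∖N[v]∣<∣W∣ v∈W) t
              (noIM ∘ inducedMatchingIn-extend vu v∈W u∈W ⊆-refl (∖N[]-pendant (adjacent-sym vu) only-v))
    recU : Bounded x (misIn (W ∖N[ u ])) ∣ W ∖N[ u ] ∣ t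
    recU = ih (∣W∖N[v]∣<∣W∣ u∈W) t
              (noIM ∘ inducedMatchingIn-extend vu v∈W u∈W (∖N[]-pendant vu only-u) ⊆-refl)

  pendantEdgeCase : ∀ {r} → v ∈ W → u ∈ W → Adjacent G v u → degreeIn W v ≡ 1 → degreeIn W u ≡ 2 + r →
                    Smaller W → ∀ t → ¬ InducedMatchingIn W (2 + t) → Bounded x (misIn W) ∣ W ∣ (suc t)
  pendantEdgeCase {v} {W} {u} {r} v∈W u∈W vu deg[v]≡1 deg[u]≡2+r ih t noIM =
    bounded-resize (sym ∣W∣≡3+k)
      (bounded-≤ (misIn-pendant v∈W only-u)
        (bounded-pendant (bounded-resize ∣W∖N[v]∣≡1+k recV) (bounded-size-≤ (m≤n+m _ r) recU)))
    where
    only-u : ∀ {w} → w ∈ W → Adjacent G v w → w ≡ u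
    only-u = degreeIn≡1⇒unique deg[v]≡1 u∈W vu
    k : ℕ
    k = r + ∣ W ∖N[ u ] ∣
    ∣W∣≡3+k : ∣ W ∣ ≡ 3 + k
    ∣W∣≡3+k = ∣W∣≡1+d+∣W∖N[v]∣ u∈W deg[u]≡2+r
    ∣W∖N[v]∣≡1+k : ∣ W ∖N[ v ] ∣ ≡ 1 + k
    ∣W∖N[v]∣≡1+k = suc-injective (suc-injective (trans (sym (∣W∣≡1+d+∣W∖N[v]∣ v∈W deg[v]≡1)) ∣W∣≡3+k))
    recV : Bounded x (misIn (W ∖N[ v ])) ∣ W ∖N[ v ] ∣ (suc t)
    recV = ih (∣W∖N[v]∣<∣W∣ v∈W) (suc t) (noIM ∘ inducedMatchingIn-mono ∖N[]⊆)
    recU : Bounded x (misIn (W ∖N[ u ])) ∣ W ∖N[ u ] ∣ t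
    recU = ih (∣W∖N[v]∣<∣W∣ u∈W) t
              (noIM ∘ inducedMatchingIn-extend vu v∈W u∈W (∖N[]-pendant vu only-u) ⊆-refl)

  pendantCase : v ∈ W → degreeIn W v ≡ 1 → Smaller W → MisBounded W
  pendantCase {v} {W} v∈W deg[v]≡1 ih t noIM with neighbourIn {W = W} {v} (≤-reflexive (sym deg[v]≡1))
  ... | u , u∈W , vu with t | degreeIn W u in deg[u]
  ...   | zero   | _           = contradiction (edge⇒inducedMatchingIn vu v∈W u∈W) noIM
  ...   | suc t′ | 0           = contradiction deg[u] (>⇒≢ (0<degreeIn v∈W (adjacent-sym vu)))
  ...   | suc t′ | 1           = isolatedEdgeCase v∈W u∈W vu deg[v]≡1 deg[u] ih t′ noIM
  ...   | suc t′ | suc (suc r) = pendantEdgeCase v∈W u∈W vu deg[v]≡1 deg[u] ih t′ noIM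

  -- In H = W − v the vertex a is pendant with neighbour a′, and triangle-freeness keeps a′ of degree 2 in H.
  pathCase : ∀ {a a′} → v ∈ W → a ∈ W → a′ ∈ W → Adjacent G v a → Adjacent G a a′ → a′ ≢ v →
             (∀ {u} → u ∈ W → degreeIn W u ≡ 2) → Smaller W → MisBounded W
  pathCase v∈W a∈W _ va _ _ _ _ zero noIM = contradiction (edge⇒inducedMatchingIn va v∈W a∈W) noIM
  pathCase {v} {W} {a} {a′} v∈W a∈W a′∈W va aa′ a′≢v deg≡2 ih (suc t) noIM =
    bounded-resize (sym ∣W∣≡4+k)
      (bounded-≤ (≤-trans misIn-branch (+-monoʳ-≤ _ (misIn-pendant a∈H only-a′)))
        (bounded-cycle (bounded-resize ∣W∖N[v]∣≡1+k recV) (bounded-size-≤ ∣H∖N[a]∣≤1+k recHa) recHa′))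
    where
    H : Subset n
    H = W - v
    H⊆W : H ⊆ W
    H⊆W = p─q⊆p W _
    a∈H : a ∈ H
    a∈H = x∈p∧x≢y⇒x∈p-y a∈W (adjacent⇒≢ (adjacent-sym va))
    a′∈H : a′ ∈ H
    a′∈H = x∈p∧x≢y⇒x∈p-y a′∈W a′≢v
    only-a′ : ∀ {z} → z ∈ H → Adjacent G a z → z ≡ a′
    only-a′ = degreeIn≡2⇒unique (deg≡2 a∈W) v∈W (adjacent-sym va) a′∈W aa′ a′≢v
    v∉N[a′] : v ∉ nbhd a′
    v∉N[a′] v∈N[a′] = triangleFree v a a′ va aa′ (adjacent-sym (∈nbhd⁻ v∈N[a′]))
    k : ℕ
    k = ∣ H ∖N[ a′ ] ∣
    ∣H∣≡3+k : ∣ H ∣ ≡ 3 + k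
    ∣H∣≡3+k = ∣W∣≡1+d+∣W∖N[v]∣ a′∈H (trans (degreeIn-delete {W = W} v∉N[a′]) (deg≡2 a′∈W))
    ∣W∣≡4+k : ∣ W ∣ ≡ 4 + k
    ∣W∣≡4+k = trans (∣p∣≡1+∣p-x∣ v∈W) (cong suc ∣H∣≡3+k)
    ∣W∖N[v]∣≡1+k : ∣ W ∖N[ v ] ∣ ≡ 1 + k
    ∣W∖N[v]∣≡1+k = suc-injective (suc-injective (suc-injective
                      (trans (sym (∣W∣≡1+d+∣W∖N[v]∣ v∈W (deg≡2 v∈W))) ∣W∣≡4+k)))
    ∣H∖N[a]∣≤1+k : ∣ H ∖N[ a ] ∣ ≤ 1 + k
    ∣H∖N[a]∣≤1+k = ≤-pred (begin
      1 + ∣ H ∖N[ a ] ∣             ≤⟨ +-monoˡ-≤ _ (0<degreeIn a′∈H aa′) ⟩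
      degreeIn H a + ∣ H ∖N[ a ] ∣  ≡⟨ suc-injective (trans (sym (∣W∣≡1+d+∣W∖N[v]∣ a∈H refl)) ∣H∣≡3+k) ⟩
      2 + k                         ∎)
      where open ≤-Reasoning
    recV : Bounded x (misIn (W ∖N[ v ])) ∣ W ∖N[ v ] ∣ (suc t)
    recV = ih (∣W∖N[v]∣<∣W∣ v∈W) (suc t) (noIM ∘ inducedMatchingIn-mono ∖N[]⊆)
    recHa : Bounded x (misIn (H ∖N[ a ])) ∣ H ∖N[ a ] ∣ (suc t)
    recHa = ih (<-trans (∣W∖N[v]∣<∣W∣ a∈H) (x∈p⇒∣p-x∣<∣p∣ v∈W)) (suc t)
               (noIM ∘ inducedMatchingIn-mono (H⊆W ∘ ∖N[]⊆))
    recHa′ : Bounded x (misIn (H ∖N[ a′ ])) k t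
    recHa′ = ih (<-trans (∣W∖N[v]∣<∣W∣ a′∈H) (x∈p⇒∣p-x∣<∣p∣ v∈W)) t
                (noIM ∘ inducedMatchingIn-extend aa′ a∈W a′∈W (∖N[]-mono H⊆W ∘ ∖N[]-pendant aa′ only-a′)
                                                              (∖N[]-mono H⊆W))

  twoRegularCase : v ∈ W → (∀ {u} → u ∈ W → degreeIn W u ≡ 2) → Smaller W → MisBounded W
  twoRegularCase {v} {W} v∈W deg≡2 ih t noIM
    with neighbourIn {W = W} {v} (subst (0 <_) (sym (deg≡2 v∈W)) (s≤s z≤n))
  ... | a , a∈W , va with degreeIn≡2⇒other (deg≡2 a∈W) v∈W (adjacent-sym va)
  ...   | a′ , a′∈W , aa′ , a′≢v = pathCase v∈W a∈W a′∈W va aa′ a′≢v deg≡2 ih t noIM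

  misBounded : ∀ W → MisBounded W
  misBounded = All.wfRec (On.wellFounded ∣_∣ <-wellFounded) 0ℓ MisBounded step
    where
    step : ∀ W → Smaller W → MisBounded W
    step W ih with degreeCase W
    ... | empty W-empty          = emptyCase W-empty
    ... | isolated v∈W deg≡0     = isolatedCase v∈W deg≡0 ih
    ... | pendant v∈W deg≡1      = pendantCase v∈W deg≡1 ih
    ... | highDegree v∈W deg≡3+r = highDegreeCase v∈W deg≡3+r ih
    ... | 2-regular v∈W deg≡2    = twoRegularCase v∈W deg≡2 ih

theorem6 : (n t : ℕ) → 1 ≤ n → (G : Graph n) → TriangleFree G →
    ¬ InducedMatching G (suc t) → BoundedBy2^tc^[n-2t] (mis G) n t
theorem6 n t _ G triangleFree noIM = bounded⇒BoundedBy2^tc^[n-2t] λ x admissible →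
  let open Recurrences admissible in
  bounded-≤ (InducedSubgraph.mis≤misIn⊤ G)
    (bounded-size-≤ (≤-reflexive (∣⊤∣≡n n)) (misBounded G triangleFree admissible ⊤ t (noIM ∘ proj₁)))
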